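{- Let $G$ be a graph with non-empty edge set and let $p\ge1$. Then $G\circ K_p$ is $1$-well-covered if and only if $p\ge2$.
   Context: Graphs are finite, simple, undirected. $G\circ K_p$ is the corona: the disjoint union of $G$ and $|V(G)|$ copies of the complete graph $K_p$, one copy $H_v$ for each $v\in V(G)$, with additional edges joining each $v$ to all vertices of $H_v$. A graph is well-covered if all its maximal (by inclusion) independent sets have the same cardinality. A well-covered graph with at least two vertices is $1$-well-covered if $G-v$ (the subgraph induced by $V(G)\setminus\{v\}$) is well-covered for every vertex $v$. -}

module Defs where

open import Data.Nat using (ℕ; zero; suc; _*_; _≤_)
open import Data.Fin using (Fin; zero; suc; punchIn; remQuot)
open import Data.Fin.Subset using (Subset; _∈_; _⊆_; ∣_∣)
open import Data.Product using (Σ; _×_; _,_; proj₁; proj₂; ∃₂)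
open import Data.Sum using (_⊎_)
open import Data.Empty using (⊥)
open import Relation.Nullary using (¬_)
open import Relation.Binary.PropositionalEquality using (_≡_; _≢_)

record Graph (n : ℕ) : Set₁ where
  field
    Adj     : Fin n → Fin n → Set
    sym     : ∀ {x y} → Adj x y → Adj y x
    irrefl  : ∀ {x} → ¬ Adj x x
open Graph public

HasEdge : ∀ {n} → Graph n → Set
HasEdge G = ∃₂ λ x y → Adj G x y

Independent : ∀ {n} → Graph n → Subset n → Set
Independent G S = ∀ x y → x ∈ S → y ∈ S → ¬ Adj G x y

MaximalIndependent : ∀ {n} → Graph n → Subset n → Set
MaximalIndependent G S =
  Independent G S × (∀ T → S ⊆ T → Independent G T → T ≡ S)

WellCovered : ∀ {n} → Graph n → Set
WellCovered G = ∀ S T → MaximalIndependent G S → MaximalIndependent G T → ∣ S ∣ ≡ ∣ T ∣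

deleteVertex : ∀ {m} → Graph (suc m) → Fin (suc m) → Graph m
deleteVertex G v = record
  { Adj    = λ x y → Adj G (punchIn v x) (punchIn v y)
  ; sym    = sym G
  ; irrefl = irrefl G
  }

OneWellCovered : ∀ {n} → Graph n → Set
OneWellCovered {zero}  G = ⊥
OneWellCovered {suc m} G =
  2 ≤ suc m × WellCovered G × (∀ v → WellCovered (deleteVertex G v))

-- Vertex set Fin (n * suc p) ≅ Fin n × Fin (suc p)
-- (via remQuot): the pair (v , zero) is the vertex v of G, and
-- (v , suc i) for i : Fin p is the i-th vertex of the copy H_v of K_p.
CoronaAdj : ∀ {n} (p : ℕ) → Graph n → Fin n × Fin (suc p) → Fin n × Fin (suc p) → Set
CoronaAdj p G (v , i) (w , j) =
  (i ≡ zero × j ≡ zero × Adj G v w) ⊎ (v ≡ w × i ≢ j)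

corona : ∀ {n} → Graph n → (p : ℕ) → Graph (n * suc p)
corona {n} G p = record
  { Adj    = λ x y → CoronaAdj p G (remQuot (suc p) x) (remQuot (suc p) y)
  ; sym    = symC
  ; irrefl = irrC
  }
  where
  open import Data.Sum using (inj₁; inj₂)
  open import Relation.Binary.PropositionalEquality using (refl) renaming (sym to ≡-sym)
  symC : ∀ {x y} → CoronaAdj p G (remQuot (suc p) x) (remQuot (suc p) y)
                 → CoronaAdj p G (remQuot (suc p) y) (remQuot (suc p) x)
  symC (inj₁ (a , b , e)) = inj₁ (b , a , Graph.sym G e)
  symC (inj₂ (a , b))     = inj₂ (≡-sym a , λ e → b (≡-sym e))
  irrC : ∀ {x} → ¬ CoronaAdj p G (remQuot (suc p) x) (remQuot (suc p) x)
  irrC (inj₁ (_ , _ , e)) = Graph.irrefl G e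
  irrC (inj₂ (_ , b))     = b refl

-- The corona G ∘ K_p, and every graph obtained from it by deleting one vertex, is
-- partitioned into the cliques {v} ∪ H_v. An independent set meets each clique at
-- most once, and a maximal one meets every clique containing a simplicial vertex
-- (all of whose neighbours lie in its own clique). Hence if every clique has a
-- simplicial vertex, all maximal independent sets have one vertex per clique. The
-- vertices of H_v are simplicial, and for p ≥ 2 every clique keeps one of them
-- after any single deletion. For p = 1 and an edge uw, deleting the vertex of H_u
-- leaves u alone in its clique, and {u} ∪ ⋃_{v≠u} H_v, {w} ∪ ⋃_{v≠u,w} H_v are
-- maximal independent sets of different sizes.
module Submission where

open import Defs hiding (sym)
open import Data.Nat using (ℕ; zero; suc; _+_; _*_; _≤_; _<_; z≤n; s≤s)
open import Data.Nat.Properties using (<-irrefl; module ≤-Reasoning)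
open import Data.Fin using (Fin; zero; suc; punchIn; punchOut; remQuot; combine)
open import Data.Fin.Properties
  using (_≟_; ¬Fin0; 0≢1+n; suc-injective; any?; punchIn-injective; punchInᵢ≢i; punchIn-punchOut;
         remQuot-combine; combine-remQuot)
open import Data.Fin.Subset using (Subset; inside; outside; _∈_; _∉_; _⊆_; _∪_; ⁅_⁆; ∣_∣)
open import Data.Fin.Subset.Properties
  using (_∈?_; drop-there; ⊆-antisym; p⊆p∪q; q⊆p∪q; x∈p∪q⁻; x∈⁅x⁆; x∈⁅y⁆⇒x≡y; p⊂q⇒∣p∣<∣q∣)
open import Data.Vec using ([]; _∷_; here; there; tabulate)
open import Data.Vec.Properties using (lookup∘tabulate; lookup⇒[]=; []=⇒lookup)
open import Data.Product using (∃; _×_; _,_; proj₁; proj₂; uncurry)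
open import Data.Product.Properties using (×-≡,≡→≡)
open import Data.Sum using (inj₁; inj₂)
open import Data.Empty using (⊥-elim)
open import Function using (_∘_; id; case_of_)
open import Function.Bundles using (_⇔_; mk⇔)
open import Function.Definitions using (Injective)
open import Relation.Nullary using (¬_; yes; no; does)
open import Relation.Nullary.Decidable using (dec-true; ¬?; _×-dec_)
open import Relation.Unary using (Pred; Decidable)
open import Relation.Binary.PropositionalEquality
  using (_≡_; _≢_; refl; sym; trans; cong; subst; subst₂; module ≡-Reasoning)

⟦_⟧ : ∀ {m ℓ} {P : Pred (Fin m) ℓ} → Decidable P → Subset m
⟦ P? ⟧ = tabulate (does ∘ P?)

∈⟦⟧⁺ : ∀ {m ℓ} {P : Pred (Fin m) ℓ} (P? : Decidable P) {x} → P x → x ∈ ⟦ P? ⟧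
∈⟦⟧⁺ P? {x} px = lookup⇒[]= x _ (trans (lookup∘tabulate _ x) (dec-true (P? x) px))

∈⟦⟧⁻ : ∀ {m ℓ} {P : Pred (Fin m) ℓ} (P? : Decidable P) {x} → x ∈ ⟦ P? ⟧ → P x
∈⟦⟧⁻ P? {x} x∈ with P? x | trans (sym (lookup∘tabulate (does ∘ P?) x)) ([]=⇒lookup x∈)
... | yes px | _ = px

enumeration⇒∣p∣≡n : ∀ {m n} (p : Subset m) (f : Fin n → Fin m) → Injective _≡_ _≡_ f →
  (∀ i → f i ∈ p) → (∀ {x} → x ∈ p → ∃ λ i → f i ≡ x) → ∣ p ∣ ≡ n

suc-enumeration⇒∣p∣≡n : ∀ {m n b} (p : Subset m) (f : Fin n → Fin (suc m)) →
  Injective _≡_ _≡_ f → (∀ i → f i ≢ zero) → (∀ i → f i ∈ b ∷ p) →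
  (∀ {x} → x ∈ p → ∃ λ i → f i ≡ suc x) → ∣ p ∣ ≡ n

enumeration⇒∣p∣≡n {n = zero}  [] f _ _ _ = refl
enumeration⇒∣p∣≡n {n = suc _} [] f _ _ _ = ⊥-elim (¬Fin0 (f zero))
enumeration⇒∣p∣≡n (outside ∷ p) f inj f∈ ∈f =
  suc-enumeration⇒∣p∣≡n p f inj f≢0 f∈ (∈f ∘ there)
  where
  f≢0 : ∀ i → f i ≢ zero
  f≢0 i fi≡0 = case subst (_∈ outside ∷ p) fi≡0 (f∈ i) of λ ()
enumeration⇒∣p∣≡n {n = zero}  (inside ∷ p) f _ _ ∈f = ⊥-elim (¬Fin0 (proj₁ (∈f here)))
enumeration⇒∣p∣≡n {n = suc _} (inside ∷ p) f inj f∈ ∈f =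
  cong suc (suc-enumeration⇒∣p∣≡n p (f ∘ punchIn i₀) (punchIn-injective i₀ _ _ ∘ inj)
                                    f∘punchIn≢0 (f∈ ∘ punchIn i₀) ∈f∘punchIn)
  where
  i₀ = proj₁ (∈f here)
  fi₀≡0 = proj₂ (∈f here)
  f∘punchIn≢0 : ∀ j → f (punchIn i₀ j) ≢ zero
  f∘punchIn≢0 j e = punchInᵢ≢i i₀ j (inj (trans e (sym fi₀≡0)))
  ∈f∘punchIn : ∀ {x} → x ∈ p → ∃ λ j → f (punchIn i₀ j) ≡ suc x
  ∈f∘punchIn x∈p with ∈f (there x∈p)
  ... | i , fi≡sx = punchOut i₀≢i , trans (cong f (punchIn-punchOut i₀≢i)) fi≡sx
    where
    i₀≢i : i₀ ≢ i
    i₀≢i refl = 0≢1+n (trans (sym fi₀≡0) fi≡sx)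

suc-enumeration⇒∣p∣≡n {b = b} p f inj f≢0 f∈ ∈f = enumeration⇒∣p∣≡n p g g-inj g∈ ∈g
  where
  0≢f : ∀ i → zero ≢ f i
  0≢f i = f≢0 i ∘ sym
  g = λ i → punchOut (0≢f i)
  suc-g : ∀ i → suc (g i) ≡ f i
  suc-g i = punchIn-punchOut (0≢f i)
  g-inj : Injective _≡_ _≡_ g
  g-inj {i} {j} e = inj (trans (sym (suc-g i)) (trans (cong suc e) (suc-g j)))
  g∈ : ∀ i → g i ∈ p
  g∈ i = drop-there (subst (_∈ b ∷ p) (sym (suc-g i)) (f∈ i))
  ∈g : ∀ {x} → x ∈ p → ∃ λ i → g i ≡ x
  ∈g x∈p with ∈f x∈p
  ... | i , fi≡sx = i , suc-injective (trans (suc-g i) fi≡sx)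

module _ {m} (H : Graph m) where

  independent-∪⁅⁆ : ∀ {S x} → Independent H S → (∀ y → y ∈ S → ¬ Adj H x y) →
    Independent H (S ∪ ⁅ x ⁆)
  independent-∪⁅⁆ {S} {x} ind x≁S a b a∈ b∈ with x∈p∪q⁻ S ⁅ x ⁆ a∈ | x∈p∪q⁻ S ⁅ x ⁆ b∈
  ... | inj₁ a∈S | inj₁ b∈S = ind a b a∈S b∈S
  ... | inj₂ a≡x | inj₁ b∈S rewrite x∈⁅y⁆⇒x≡y x a≡x = x≁S b b∈S
  ... | inj₁ a∈S | inj₂ b≡x rewrite x∈⁅y⁆⇒x≡y x b≡x = x≁S a a∈S ∘ Graph.sym H
  ... | inj₂ a≡x | inj₂ b≡x rewrite x∈⁅y⁆⇒x≡y x a≡x | x∈⁅y⁆⇒x≡y x b≡x = irrefl H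

  dominating⇒maximal : ∀ {S} → Independent H S → (∀ a → a ∉ S → ∃ λ b → b ∈ S × Adj H a b) →
    MaximalIndependent H S
  dominating⇒maximal {S} ind dom = ind , λ T S⊆T indT → ⊆-antisym (T⊆S S⊆T indT) S⊆T
    where
    T⊆S : ∀ {T} → S ⊆ T → Independent H T → T ⊆ S
    T⊆S S⊆T indT {a} a∈T with a ∈? S
    ... | yes a∈S = a∈S
    ... | no a∉S with dom a a∉S
    ... | b , b∈S , a~b = ⊥-elim (indT a b a∈T (S⊆T b∈S) a~b)

module CliquePartition {m k} (H : Graph m) (block : Fin m → Fin k)
  (block-clique : ∀ {a b} → block a ≡ block b → a ≢ b → Adj H a b) where

  Simplicial : Fin m → Set
  Simplicial a = ∀ {b} → Adj H a b → block b ≡ block a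

  OnePerBlock : Subset m → Set
  OnePerBlock S = ∀ {a b} → a ∈ S → b ∈ S → block a ≡ block b → a ≡ b

  independent⇒onePerBlock : ∀ {S} → Independent H S → OnePerBlock S
  independent⇒onePerBlock ind {a} {b} a∈ b∈ e with a ≟ b
  ... | yes a≡b = a≡b
  ... | no a≢b = ⊥-elim (ind a b a∈ b∈ (block-clique e a≢b))

  simplicial⇒nonadjacent : ∀ {S a b} → OnePerBlock S → a ∈ S → b ∈ S → Simplicial a →
    ¬ Adj H a b
  simplicial⇒nonadjacent one a∈ b∈ simplicial-a a~b =
    irrefl H (subst (Adj H _) (one b∈ a∈ (simplicial-a a~b)) a~b)

  onePerBlock⇒independent : ∀ {S} x → OnePerBlock S → (∀ {a} → a ∈ S → a ≢ x → Simplicial a) →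
    Independent H S
  onePerBlock⇒independent x one simplicial a b a∈ b∈ with a ≟ x | b ≟ x
  ... | no a≢x | _ = simplicial⇒nonadjacent one a∈ b∈ (simplicial a∈ a≢x)
  ... | yes _ | no b≢x = simplicial⇒nonadjacent one b∈ a∈ (simplicial b∈ b≢x) ∘ Graph.sym H
  ... | yes refl | yes refl = irrefl H

  block-dominates : ∀ {S a b} → a ∉ S → b ∈ S → block b ≡ block a → Adj H a b
  block-dominates {S} a∉S b∈S e = block-clique (sym e) λ { refl → a∉S b∈S }

  section⇒∣S∣≡k : ∀ {S} → OnePerBlock S → (r : Fin k → Fin m) → (∀ i → block (r i) ≡ i) →
    (∀ i → r i ∈ S) → ∣ S ∣ ≡ k
  section⇒∣S∣≡k one r r-section r∈ = enumeration⇒∣p∣≡n _ r r-injective r∈ ∈r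
    where
    r-injective : Injective _≡_ _≡_ r
    r-injective {i} {j} e = trans (sym (r-section i)) (trans (cong block e) (r-section j))
    ∈r : ∀ {a} → a ∈ _ → ∃ λ i → r i ≡ a
    ∈r {a} a∈ = block a , one (r∈ (block a)) a∈ (r-section (block a))

  maximal⇒meets-simplicial-block : ∀ {S s} → MaximalIndependent H S → Simplicial s →
    ∃ λ a → a ∈ S × block a ≡ block s
  maximal⇒meets-simplicial-block {S} {s} (ind , maximal) simplicial-s
    with any? (λ a → (a ∈? S) ×-dec (block a ≟ block s))
  ... | yes meets = meets
  ... | no misses = ⊥-elim (misses (s , s∈S , refl))
    where
    s≁S : ∀ y → y ∈ S → ¬ Adj H s y
    s≁S y y∈S s~y = misses (y , y∈S , simplicial-s s~y)
    s∈S : s ∈ S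
    s∈S = subst (s ∈_) (maximal _ (p⊆p∪q ⁅ s ⁆) (independent-∪⁅⁆ H ind s≁S))
                (q⊆p∪q S ⁅ s ⁆ (x∈⁅x⁆ s))

  simplicial-blocks⇒wellCovered : (∀ i → ∃ λ s → block s ≡ i × Simplicial s) → WellCovered H
  simplicial-blocks⇒wellCovered simplicial S T S-max T-max =
    trans (maximal⇒∣S∣≡k S-max) (sym (maximal⇒∣S∣≡k T-max))
    where
    maximal⇒∣S∣≡k : ∀ {S} → MaximalIndependent H S → ∣ S ∣ ≡ k
    maximal⇒∣S∣≡k S-max = section⇒∣S∣≡k (independent⇒onePerBlock (proj₁ S-max)) r r-section r∈
      where
      meets : ∀ i → ∃ λ a → a ∈ _ × block a ≡ block (proj₁ (simplicial i))
      meets i = maximal⇒meets-simplicial-block S-max (proj₂ (proj₂ (simplicial i)))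
      r = λ i → proj₁ (meets i)
      r∈ = λ i → proj₁ (proj₂ (meets i))
      r-section = λ i → trans (proj₂ (proj₂ (meets i))) (proj₁ (proj₂ (simplicial i)))

  transversal : (Fin k → Fin m) → Subset m
  transversal r = ⟦ (λ a → a ≟ r (block a)) ⟧

  module Transversal (r : Fin k → Fin m) (r-section : ∀ i → block (r i) ≡ i) where

    ∈transversal⁺ : ∀ {a} → a ≡ r (block a) → a ∈ transversal r
    ∈transversal⁺ = ∈⟦⟧⁺ (λ a → a ≟ r (block a))

    ∈transversal⁻ : ∀ {a} → a ∈ transversal r → a ≡ r (block a)
    ∈transversal⁻ = ∈⟦⟧⁻ (λ a → a ≟ r (block a))

    r∈transversal : ∀ i → r i ∈ transversal r
    r∈transversal i = ∈transversal⁺ (cong r (sym (r-section i)))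

    transversal-onePerBlock : OnePerBlock (transversal r)
    transversal-onePerBlock a∈ b∈ e =
      trans (∈transversal⁻ a∈) (trans (cong r e) (sym (∈transversal⁻ b∈)))

    ∣transversal∣≡k : ∣ transversal r ∣ ≡ k
    ∣transversal∣≡k = section⇒∣S∣≡k transversal-onePerBlock r r-section r∈transversal

    transversal-dominating : ∀ a → a ∉ transversal r → ∃ λ b → b ∈ transversal r × Adj H a b
    transversal-dominating a a∉ =
      r (block a) , r∈transversal (block a) , block-dominates a∉ (r∈transversal _) (r-section _)

  -- S₂ takes a₀ and a simplicial vertex from every other block; S₁ replaces a₀ and the
  -- vertex taken from the block of b by b alone.
  module _ (a₀ b : Fin m) (a₀~b : Adj H a₀ b) (alone : ∀ {a} → block a ≡ block a₀ → a ≡ a₀)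
    (simplicial : ∀ i → i ≢ block a₀ → ∃ λ s → block s ≡ i × Simplicial s) where

    r₂ : Fin k → Fin m
    r₂ i with i ≟ block a₀
    ... | yes _  = a₀
    ... | no i≢ = proj₁ (simplicial i i≢)

    r₂-section : ∀ i → block (r₂ i) ≡ i
    r₂-section i with i ≟ block a₀
    ... | yes i≡ = sym i≡
    ... | no i≢ = proj₁ (proj₂ (simplicial i i≢))

    r₂-simplicial : ∀ i → r₂ i ≢ a₀ → Simplicial (r₂ i)
    r₂-simplicial i with i ≟ block a₀
    ... | yes _ = λ a₀≢a₀ → ⊥-elim (a₀≢a₀ refl)
    ... | no i≢ = λ _ → proj₂ (proj₂ (simplicial i i≢))

    r₁ : Fin k → Fin m
    r₁ i with i ≟ block b
    ... | yes _ = b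
    ... | no _  = r₂ i

    r₁-section : ∀ i → block (r₁ i) ≡ i
    r₁-section i with i ≟ block b
    ... | yes i≡ = sym i≡
    ... | no _   = r₂-section i

    r₁-simplicial : ∀ i → r₁ i ≢ a₀ → r₁ i ≢ b → Simplicial (r₁ i)
    r₁-simplicial i with i ≟ block b
    ... | yes _ = λ _ b≢b → ⊥-elim (b≢b refl)
    ... | no _  = λ r₂i≢a₀ _ → r₂-simplicial i r₂i≢a₀

    b≡r₁ : b ≡ r₁ (block b)
    b≡r₁ with block b ≟ block b
    ... | yes _ = refl
    ... | no b≢b = ⊥-elim (b≢b refl)

    module T₁ = Transversal r₁ r₁-section
    module T₂ = Transversal r₂ r₂-section

    in-S₁? : Decidable (λ a → a ≢ a₀ × a ≡ r₁ (block a))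
    in-S₁? a = ¬? (a ≟ a₀) ×-dec a ≟ r₁ (block a)

    S₁ S₂ : Subset m
    S₁ = ⟦ in-S₁? ⟧
    S₂ = transversal r₂

    ∈S₁⁺ : ∀ {a} → a ≢ a₀ → a ≡ r₁ (block a) → a ∈ S₁
    ∈S₁⁺ a≢a₀ a≡ = ∈⟦⟧⁺ in-S₁? (a≢a₀ , a≡)

    ∈S₁⁻ : ∀ {a} → a ∈ S₁ → a ≢ a₀ × a ≡ r₁ (block a)
    ∈S₁⁻ = ∈⟦⟧⁻ in-S₁?

    S₁⊆T₁ : S₁ ⊆ transversal r₁
    S₁⊆T₁ a∈ = T₁.∈transversal⁺ (proj₂ (∈S₁⁻ a∈))

    b≢a₀ : b ≢ a₀
    b≢a₀ refl = irrefl H a₀~b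

    S₁-maximal : MaximalIndependent H S₁
    S₁-maximal = dominating⇒maximal H (onePerBlock⇒independent b one simplicial-S₁) dominating
      where
      one : OnePerBlock S₁
      one a∈ b∈ = T₁.transversal-onePerBlock (S₁⊆T₁ a∈) (S₁⊆T₁ b∈)
      simplicial-S₁ : ∀ {a} → a ∈ S₁ → a ≢ b → Simplicial a
      simplicial-S₁ {a} a∈ a≢b with ∈S₁⁻ a∈
      ... | a≢a₀ , a≡ =
        subst Simplicial (sym a≡) (r₁-simplicial (block a) (a≢a₀ ∘ trans a≡) (a≢b ∘ trans a≡))
      dominating : ∀ a → a ∉ S₁ → ∃ λ c → c ∈ S₁ × Adj H a c
      dominating a a∉ with a ≟ a₀
      ... | yes refl = b , ∈S₁⁺ b≢a₀ b≡r₁ , a₀~b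
      ... | no a≢a₀ = r₁ (block a) , c∈ , block-dominates a∉ c∈ (r₁-section (block a))
        where
        c∈ : r₁ (block a) ∈ S₁
        c∈ = ∈S₁⁺ (λ c≡a₀ → a≢a₀ (alone (trans (sym (r₁-section _)) (cong block c≡a₀))))
                  (cong r₁ (sym (r₁-section (block a))))

    S₂-maximal : MaximalIndependent H S₂
    S₂-maximal = dominating⇒maximal H
      (onePerBlock⇒independent a₀ T₂.transversal-onePerBlock simplicial-S₂)
      T₂.transversal-dominating
      where
      simplicial-S₂ : ∀ {a} → a ∈ S₂ → a ≢ a₀ → Simplicial a
      simplicial-S₂ {a} a∈ a≢a₀ =
        subst Simplicial (sym a≡) (r₂-simplicial (block a) (a≢a₀ ∘ trans a≡))
        where a≡ = T₂.∈transversal⁻ a∈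

    ∣S₁∣<∣S₂∣ : ∣ S₁ ∣ < ∣ S₂ ∣
    ∣S₁∣<∣S₂∣ = begin-strict
      ∣ S₁ ∣             <⟨ p⊂q⇒∣p∣<∣q∣ (S₁⊆T₁ , a₀ , a₀∈T₁ , λ a₀∈S₁ → proj₁ (∈S₁⁻ a₀∈S₁) refl) ⟩
      ∣ transversal r₁ ∣ ≡⟨ T₁.∣transversal∣≡k ⟩
      k                  ≡⟨ sym T₂.∣transversal∣≡k ⟩
      ∣ S₂ ∣             ∎
      where
      open ≤-Reasoning
      a₀∈T₁ : a₀ ∈ transversal r₁
      a₀∈T₁ = subst (_∈ transversal r₁) (alone (r₁-section _)) (T₁.r∈transversal (block a₀))

    ¬wellCovered : ¬ WellCovered H
    ¬wellCovered wc = <-irrefl (wc S₁ S₂ S₁-maximal S₂-maximal) ∣S₁∣<∣S₂∣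

module CoronaCoordinates {n p m} (G : Graph n) (H : Graph m)
  (c : Fin m → Fin n × Fin (suc p)) (c-injective : Injective _≡_ _≡_ c)
  (adj⁺ : ∀ {a b} → Adj H a b → CoronaAdj p G (c a) (c b))
  (adj⁻ : ∀ {a b} → CoronaAdj p G (c a) (c b) → Adj H a b) where

  block : Fin m → Fin n
  block = proj₁ ∘ c

  block-clique : ∀ {a b} → block a ≡ block b → a ≢ b → Adj H a b
  block-clique e a≢b = adj⁻ (inj₂ (e , λ e′ → a≢b (c-injective (×-≡,≡→≡ (e , e′)))))

  open CliquePartition H block block-clique public

  copyVertex⇒simplicial : ∀ {a v j} → c a ≡ (v , suc j) → Simplicial a
  copyVertex⇒simplicial ca≡ a~b with adj⁺ a~b
  ... | inj₁ (c₂≡0 , _) = ⊥-elim (0≢1+n (trans (sym c₂≡0) (cong proj₂ ca≡)))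
  ... | inj₂ (same , _) = sym same

  copyVertices⇒wellCovered : (∀ v → ∃ λ a → ∃ λ j → c a ≡ (v , suc j)) → WellCovered H
  copyVertices⇒wellCovered copy = simplicial-blocks⇒wellCovered λ v →
    let a , _ , ca≡ = copy v in a , cong proj₁ ca≡ , copyVertex⇒simplicial ca≡

remQuot-injective : ∀ {n} k → Injective _≡_ _≡_ (remQuot {n} k)
remQuot-injective {n} k {a} {b} e = begin
  a                                     ≡⟨ sym (combine-remQuot {n} k a) ⟩
  uncurry combine (remQuot {n} k a)     ≡⟨ cong (uncurry combine) e ⟩
  uncurry combine (remQuot {n} k b)     ≡⟨ combine-remQuot {n} k b ⟩
  b                                     ∎
  where open ≡-Reasoning

module Corona {n} (G : Graph n) (p : ℕ) =
  CoronaCoordinates G (corona G p) (remQuot (suc p)) (remQuot-injective (suc p)) id id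

module CoronaMinus {n} (G : Graph (suc n)) (p : ℕ) (x : Fin (suc n * suc p)) where

  c : Fin (p + n * suc p) → Fin (suc n) × Fin (suc p)
  c = remQuot (suc p) ∘ punchIn x

  c-injective : Injective _≡_ _≡_ c
  c-injective = punchIn-injective x _ _ ∘ remQuot-injective (suc p)

  open CoronaCoordinates G (deleteVertex (corona G p) x) c c-injective id id public

  x̂ : Fin (suc n) × Fin (suc p)
  x̂ = remQuot (suc p) x

  c≢x : ∀ a → c a ≢ x̂
  c≢x a = punchInᵢ≢i x a ∘ remQuot-injective (suc p)

  c-onto : ∀ q → q ≢ x̂ → ∃ λ a → c a ≡ q
  c-onto q q≢x̂ = punchOut x≢y , (begin
    c (punchOut x≢y)  ≡⟨ cong (remQuot (suc p)) (punchIn-punchOut x≢y) ⟩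
    remQuot (suc p) y ≡⟨ uncurry remQuot-combine q ⟩
    q                 ∎)
    where
    open ≡-Reasoning
    y = uncurry combine q
    x≢y : x ≢ y
    x≢y x≡y = q≢x̂ (trans (sym (uncurry remQuot-combine q)) (cong (remQuot (suc p)) (sym x≡y)))

corona-wellCovered : ∀ {n} (G : Graph n) p → WellCovered (corona G (suc p))
corona-wellCovered G p = Corona.copyVertices⇒wellCovered G (suc p) λ v →
  combine v (suc zero) , zero , remQuot-combine v (suc zero)

coronaMinus-wellCovered : ∀ {n} (G : Graph (suc n)) p x →
  WellCovered (deleteVertex (corona G (suc (suc p))) x)
coronaMinus-wellCovered G p x = copyVertices⇒wellCovered λ v →
  let j , free = spare v ; a , ca≡ = c-onto (v , suc j) free in a , j , ca≡
  where
  open CoronaMinus G (suc (suc p)) x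
  spare : ∀ v → ∃ λ j → (v , suc j) ≢ x̂
  spare v with proj₂ x̂ ≟ suc zero
  ... | yes x₂≡1 = suc zero , λ e → case trans (cong proj₂ e) x₂≡1 of λ ()
  ... | no x₂≢1  = zero , λ e → x₂≢1 (sym (cong proj₂ e))

coronaMinus-¬wellCovered : ∀ {n} (G : Graph (suc n)) {u w} → Adj G u w →
  ¬ WellCovered (deleteVertex (corona G 1) (combine u (suc zero)))
coronaMinus-¬wellCovered G {u} {w} u~w = ¬wellCovered a₀ b a₀~b alone simplicial
  where
  x = combine u (suc zero)
  open CoronaMinus G 1 x
  x≡ : x̂ ≡ (u , suc zero)
  x≡ = remQuot-combine u (suc zero)
  vertex : ∀ v → ∃ λ a → c a ≡ (v , zero)
  vertex v = c-onto (v , zero) (λ e → 0≢1+n (cong proj₂ (trans e x≡)))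
  a₀ = proj₁ (vertex u)
  b = proj₁ (vertex w)
  a₀~b : CoronaAdj 1 G (c a₀) (c b)
  a₀~b = subst₂ (CoronaAdj 1 G) (sym (proj₂ (vertex u))) (sym (proj₂ (vertex w)))
                (inj₁ (refl , refl , u~w))
  ≢1⇒≡0 : ∀ {i : Fin 2} → i ≢ suc zero → i ≡ zero
  ≢1⇒≡0 {zero}     _   = refl
  ≢1⇒≡0 {suc zero} i≢1 = ⊥-elim (i≢1 refl)
  in-block-u : ∀ a → block a ≡ u → c a ≡ (u , zero)
  in-block-u a a∈u =
    ×-≡,≡→≡ (a∈u , ≢1⇒≡0 λ c₂≡1 → c≢x a (trans (×-≡,≡→≡ (a∈u , c₂≡1)) (sym x≡)))
  block-a₀ : block a₀ ≡ u
  block-a₀ = cong proj₁ (proj₂ (vertex u))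
  alone : ∀ {a} → block a ≡ block a₀ → a ≡ a₀
  alone {a} e = c-injective (trans (in-block-u a (trans e block-a₀)) (sym (proj₂ (vertex u))))
  simplicial : ∀ v → v ≢ block a₀ → ∃ λ s → block s ≡ v × Simplicial s
  simplicial v v≢ =
    let s , cs≡ = c-onto (v , suc zero) (λ e → v≢ (trans (cong proj₁ (trans e x≡)) (sym block-a₀)))
    in s , cong proj₁ cs≡ , copyVertex⇒simplicial cs≡

corona-oneWellCovered : ∀ {n} (G : Graph (suc n)) p → OneWellCovered (corona G (suc (suc p)))
corona-oneWellCovered G p =
  s≤s (s≤s z≤n) , corona-wellCovered G (suc p) , coronaMinus-wellCovered G p

corollary4p5 : ∀ {n} (G : Graph n) (p : ℕ) → HasEdge G → 1 ≤ p →
    (OneWellCovered (corona G p) ⇔ (2 ≤ p))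
corollary4p5 {zero}  G p (() , _)
corollary4p5 {suc n} G zero _ ()
corollary4p5 {suc n} G (suc zero) (u , w , u~w) _ =
  mk⇔ (λ (_ , _ , wc-minus) → ⊥-elim (coronaMinus-¬wellCovered G u~w (wc-minus (combine u (suc zero)))))
      λ { (s≤s ()) }
corollary4p5 {suc n} G (suc (suc p)) _ _ =
  mk⇔ (λ _ → s≤s (s≤s z≤n)) (λ _ → corona-oneWellCovered G p)
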